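{- Let $I$ be a binary CSP instance and $x_i,x_j$ distinct variables of $I$. If $x_i$ justifies the elimination of $x_j$ by the triangle property in $I$ and $x_j$ justifies the elimination of $x_i$ by the triangle property in $I$, then $\mathit{NS}(I_{ -i})$ and $\mathit{NS}(I_{ -j})$ are isomorphic.
   Context: A binary CSP instance $I=\langle X,\mathcal{D},R\rangle$ consists of a finite set $X$ of variables, a finite domain $\mathcal{D}(x_i)$ for each variable, and for each ordered pair of distinct variables $(x_i,x_j)$ a relation $R_{ij}\subseteq \mathcal{D}(x_i)\times\mathcal{D}(x_j)$, with $R_{ji}$ the transpose of $R_{ij}$. Eliminating a variable $x_m$ from $I$ produces the instance $I_{ -m}$ obtained by (1) deleting, for each $q\neq m$, every $v_q\in\mathcal{D}(x_q)$ having no compatible value in $\mathcal{D}(x_m)$, and (2) deleting $x_m$ and all constraints involving $x_m$. For distinct $x_i,x_j$, $x_j$ justifies the elimination by the triangle property of $x_i$ in $I$ if for every $v_j\in\mathcal{D}(x_j)$ there exists $u\in\mathcal{D}(x_i)$ with $(u,v_j)\in R_{ij}$ and such that for all $x_k\in X\setminus\{x_i,x_j\}$ and all $v_k\in\mathcal{D}(x_k)$, $(v_j,v_k)\in R_{jk}$ implies $(u,v_k)\in R_{ik}$. A value $v_i\in\mathcal{D}(x_i)$ is neighbourhood substitutable by $v'_i\in\mathcal{D}(x_i)\setminus\{v_i\}$ if for all $x_j\neq x_i$ and all $v_j\in\mathcal{D}(x_j)$, $(v_i,v_j)\in R_{ij}$ implies $(v'_i,v_j)\in R_{ij}$. $\mathit{NS}(J)$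 denotes the result of repeatedly deleting from instance $J$ values that are neighbourhood substitutable (by some other remaining value of the same domain) until no such value remains; this result is known to be unique up to isomorphism. Two instances $I=\langle X^I,\mathcal{D}^I,R^I\rangle$ and $J=\langle X^J,\mathcal{D}^J,R^J\rangle$ are isomorphic if there are bijections $f:X^I\to X^J$ and $g_i:\mathcal{D}^I(x_i)\to\mathcal{D}^J(f(x_i))$ for each $x_i\in X^I$ such that for all distinct $x_i,x_j\in X^I$, $v_i\in\mathcal{D}^I(x_i)$, $v_j\in\mathcal{D}^I(x_j)$: $(v_i,v_j)\in R^I_{ij}$ iff $(g_i(v_i),g_j(v_j))\in R^J_{f(x_i)f(x_j)}$. -}

module Defs where

open import Data.Nat using (ℕ)
open import Data.Fin using (Fin; _≟_)
open import Data.Bool using (Bool; true; false; T; _∧_; _∨_; not; if_then_else_)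
open import Data.List using (allFin)
open import Data.Bool.ListAction using (any)
open import Data.Product using (Σ; Σ-syntax; ∃; _×_; _,_; proj₁; proj₂)
open import Relation.Nullary using (¬_; yes; no)
open import Relation.Nullary.Decidable using (⌊_⌋)
open import Relation.Binary.PropositionalEquality using (_≡_; _≢_; refl)
open import Relation.Binary.Construct.Closure.ReflexiveTransitive using (Star)
open import Function.Bundles using (_↔_; Inverse)

-- Variables are the elements of Fin n that are
-- active (X x ≡ true); the domain of a variable x is the set of active
-- values v : Fin (d x) (D x v ≡ true).
-- Using explicit "active" masks lets elimination / value deletion keep the
-- same underlying index types.
record Instance : Set where
  field
    n     : ℕ
    X     : Fin n → Bool
    d     : Fin n → ℕ
    D     : (x : Fin n) → Fin (d x) → Bool
    R     : (x y : Fin n) → Fin (d x) → Fin (d y) → Bool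
    R-sym : ∀ x y → x ≢ y → ∀ u v → R x y u v ≡ R y x v u

open Instance public

-- I_{-m}: delete unsupported values, then delete variable m.
elim : (I : Instance) → Fin (n I) → Instance
elim I m = record
  { n = n I
  ; X = λ k → X I k ∧ not ⌊ k ≟ m ⌋
  ; d = d I
  ; D = λ q v → D I q v ∧
          (⌊ q ≟ m ⌋ ∨ any (λ u → D I m u ∧ R I q m v u) (allFin (d I m)))
  ; R = R I
  ; R-sym = R-sym I
  }

-- "x_j justifies the elimination by the triangle property of x_i in I"
TriangleJustifies : (I : Instance) (j i : Fin (n I)) → Set
TriangleJustifies I j i =
  (vj : Fin (d I j)) → T (D I j vj) →
  Σ[ u ∈ Fin (d I i) ] (T (D I i u) × T (R I i j u vj) ×
    ((k : Fin (n I)) → T (X I k) → k ≢ i → k ≢ j →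
     (vk : Fin (d I k)) → T (D I k vk) →
     T (R I j k vj vk) → T (R I i k u vk)))

NSubst : (J : Instance) (x : Fin (n J)) (v v' : Fin (d J x)) → Set
NSubst J x v v' =
  T (X J x) × T (D J x v) × T (D J x v') × v ≢ v' ×
  ((y : Fin (n J)) → T (X J y) → y ≢ x →
   (vy : Fin (d J y)) → T (D J y vy) →
   T (R J x y v vy) → T (R J x y v' vy))

delD : ∀ {N} (dd : Fin N → ℕ) (DD : (k : Fin N) → Fin (dd k) → Bool)
       (x : Fin N) (v : Fin (dd x)) (k : Fin N) → Fin (dd k) → Bool
delD dd DD x v k w with k ≟ x
... | yes refl = if ⌊ w ≟ v ⌋ then false else DD k w
... | no _ = DD k w

deleteVal : (J : Instance) (x : Fin (n J)) → Fin (d J x) → Instance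
deleteVal J x v = record
  { n = n J ; X = X J ; d = d J ; D = delD (d J) (D J) x v
  ; R = R J ; R-sym = R-sym J }

data NSStep (J : Instance) : Instance → Set where
  step : (x : Fin (n J)) (v v' : Fin (d J x)) →
         NSubst J x v v' → NSStep J (deleteVal J x v)

IsNS : Instance → Instance → Set
IsNS J K = Star NSStep J K ×
           ((x : Fin (n K)) (v v' : Fin (d K x)) → ¬ NSubst K x v v')

Var : Instance → Set
Var I = Σ[ x ∈ Fin (n I) ] T (X I x)

Val : (I : Instance) → Fin (n I) → Set
Val I x = Σ[ v ∈ Fin (d I x) ] T (D I x v)

Isomorphic : Instance → Instance → Set
Isomorphic I J =
  Σ[ f ∈ Var I ↔ Var J ]
  Σ[ g ∈ ((x : Var I) → Val I (proj₁ x) ↔ Val J (proj₁ (Inverse.to f x))) ]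
  ((x y : Var I) → proj₁ x ≢ proj₁ y →
   (u : Val I (proj₁ x)) (w : Val I (proj₁ y)) →
   R I (proj₁ x) (proj₁ y) (proj₁ u) (proj₁ w)
     ≡ R J (proj₁ (Inverse.to f x)) (proj₁ (Inverse.to f y))
           (proj₁ (Inverse.to (g x) u)) (proj₁ (Inverse.to (g y) w)))

-- I₋ᵢ and I₋ⱼ are both obtained, up to isomorphism, from a single instance M by NS deletions.
-- M is I without xᵢ in which the domain of xⱼ is the disjoint union of the domain of xⱼ in I₋ᵢ
-- and that of xᵢ in I₋ⱼ, every value keeping its constraints from I.  Since xᵢ justifies the
-- elimination of xⱼ, every copied xᵢ-value is dominated by an xⱼ-value, so NS deletions prune
-- M to I₋ᵢ; symmetrically they prune M to I₋ⱼ with xᵢ renamed to xⱼ.  On the remaining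
-- variables the two eliminations agree, again by the triangle properties.  It then suffices
-- that NS-closures of isomorphic instances are isomorphic: any two NS deletions can be
-- completed to isomorphic instances, and every deletion shrinks the instance, so a
-- Newman-style induction applies.

module Submission where

open import Defs
open import Data.Nat using (ℕ; zero; suc; _+_; _≤_; _<_; z≤n; s≤s; s≤s⁻¹)
open import Data.Nat.Properties using (+-mono-≤; +-mono-<-≤; +-mono-≤-<; <-trans; <-≤-trans; m≤m+n; m≤n+m)
open import Data.Nat.Induction using (<-wellFounded)
open import Induction.WellFounded using (Acc; acc)
open import Data.Fin using (Fin; zero; suc; _≟_; splitAt; _↑ˡ_; _↑ʳ_)
open import Data.Fin.Properties using (splitAt-↑ˡ; splitAt-↑ʳ; splitAt⁻¹-↑ˡ; splitAt⁻¹-↑ʳ; any?; all?)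
open import Data.Bool using (Bool; true; false; T; _∧_; not; if_then_else_)
open import Data.Bool.Properties using (T-irrelevant; T-∧; T-∨)
open import Data.List using (List; []; _∷_; allFin)
open import Data.List.Membership.Propositional using (_∈_; lose)
open import Data.List.Membership.Propositional.Properties using (∈-allFin)
open import Data.List.Relation.Unary.Any using (here; there; satisfied)
open import Data.List.Relation.Unary.Any.Properties using (any⁺; any⁻)
open import Data.Sum using (_⊎_; inj₁; inj₂)
open import Data.Unit using (tt)
open import Data.Empty using (⊥-elim)
open import Data.Product using (Σ; Σ-syntax; _×_; _,_; proj₁; proj₂)
open import Relation.Nullary using (¬_; yes; no; Dec)
open import Relation.Nullary.Decidable using (⌊_⌋)
open import Relation.Nullary.Decidable.Core
  using (T?; ¬?; _×-dec_; _→-dec_; toWitness; toWitnessFalse; fromWitness; fromWitnessFalse)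
open import Data.Product.Properties using (,-injectiveˡ; ≡-dec; Σ-≡,≡→≡)
open import Data.Product.Properties.WithK using (,-injectiveʳ)
open import Data.Fin.Permutation.Components using (transpose; transpose-inverse)
open import Function.Base using (id; _∘_; _∘′_)
open import Relation.Binary.PropositionalEquality
  using (_≡_; _≢_; refl; sym; trans; cong; cong₂; subst; ≢-sym; module ≡-Reasoning)
open import Relation.Binary.Construct.Closure.ReflexiveTransitive using (Star; ε; _◅_; _◅◅_)
open import Function.Bundles using (_↔_; mk↔ₛ′; Equivalence)

T-∧ˡ : ∀ {a b} → T (a ∧ b) → T a
T-∧ˡ p = proj₁ (Equivalence.to T-∧ p)

T-∧ʳ : ∀ {a b} → T (a ∧ b) → T b
T-∧ʳ p = proj₂ (Equivalence.to T-∧ p)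

T-∧⁺ : ∀ {a b} → T a → T b → T (a ∧ b)
T-∧⁺ p q = Equivalence.from T-∧ (p , q)

T-extensional : ∀ {a b} → (T a → T b) → (T b → T a) → a ≡ b
T-extensional {false} {false} _ _ = refl
T-extensional {false} {true} _ b⇒a = ⊥-elim (b⇒a tt)
T-extensional {true} {false} a⇒b _ = ⊥-elim (a⇒b tt)
T-extensional {true} {true} _ _ = refl

Var-≡ : ∀ {J} {x y : Var J} → proj₁ x ≡ proj₁ y → x ≡ y
Var-≡ {x = x , p} {.x , q} refl = cong (x ,_) (T-irrelevant p q)

Val-≡ : ∀ {J z} {v w : Val J z} → proj₁ v ≡ proj₁ w → v ≡ w
Val-≡ {v = v , p} {.v , q} refl = cong (v ,_) (T-irrelevant p q)

Point : Instance → Set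
Point J = Σ (Var J) (λ x → Val J (proj₁ x))

RawPoint : Instance → Set
RawPoint J = Σ (Fin (n J)) (λ x → Fin (d J x))

raw : ∀ {J} → Point J → RawPoint J
raw ((x , _) , (v , _)) = x , v

raw-injective : ∀ {J} {p q : Point J} → raw {J} p ≡ raw {J} q → p ≡ q
raw-injective {p = (x , px) , (v , pv)} {(.x , qx) , (.v , qv)} refl
  rewrite T-irrelevant px qx | T-irrelevant pv qv = refl

Active : (J : Instance) → RawPoint J → Set
Active J (x , v) = T (D J x v)

Rᵖ : (J : Instance) → RawPoint J → RawPoint J → Bool
Rᵖ J (x , v) (y , w) = R J x y v w

record _≅_ (J J' : Instance) : Set where
  field
    var       : Var J → Var J'
    var⁻¹     : Var J' → Var J
    var⁻¹∘var : ∀ x → var⁻¹ (var x) ≡ x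
    var∘var⁻¹ : ∀ y → var (var⁻¹ y) ≡ y
    val       : (x : Var J) → Val J (proj₁ x) → Val J' (proj₁ (var x))
    val⁻¹     : (y : Var J') → Val J' (proj₁ y) → Val J (proj₁ (var⁻¹ y))
    val⁻¹∘val : ∀ x v → _≡_ {A = Point J} (var⁻¹ (var x) , val⁻¹ (var x) (val x v)) (x , v)
    val∘val⁻¹ : ∀ y w → _≡_ {A = Point J'} (var (var⁻¹ y) , val (var⁻¹ y) (val⁻¹ y w)) (y , w)
    R-val     : ∀ x y → proj₁ x ≢ proj₁ y → ∀ v w →
                R J (proj₁ x) (proj₁ y) (proj₁ v) (proj₁ w)
                  ≡ R J' (proj₁ (var x)) (proj₁ (var y)) (proj₁ (val x v)) (proj₁ (val y w))

  var-≢ : ∀ x y → proj₁ x ≢ proj₁ y → proj₁ (var x) ≢ proj₁ (var y)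
  var-≢ x y x≢y e = x≢y (cong proj₁ (begin
    x                ≡⟨ sym (var⁻¹∘var x) ⟩
    var⁻¹ (var x)    ≡⟨ cong var⁻¹ (Var-≡ {J'} e) ⟩
    var⁻¹ (var y)    ≡⟨ var⁻¹∘var y ⟩
    y                ∎))
    where open ≡-Reasoning

  var⁻¹-≢ : ∀ x y → proj₁ x ≢ proj₁ y → proj₁ (var⁻¹ x) ≢ proj₁ (var⁻¹ y)
  var⁻¹-≢ x y x≢y e = x≢y (cong proj₁ (begin
    x                ≡⟨ sym (var∘var⁻¹ x) ⟩
    var (var⁻¹ x)    ≡⟨ cong var (Var-≡ {J} e) ⟩
    var (var⁻¹ y)    ≡⟨ var∘var⁻¹ y ⟩
    y                ∎))
    where open ≡-Reasoning

  point : Point J → Point J'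
  point (x , v) = var x , val x v

  point⁻¹ : Point J' → Point J
  point⁻¹ (y , w) = var⁻¹ y , val⁻¹ y w

  point-injective : ∀ {p q} → point p ≡ point q → p ≡ q
  point-injective {p} {q} e =
    trans (sym (val⁻¹∘val (proj₁ p) (proj₂ p))) (trans (cong point⁻¹ e) (val⁻¹∘val (proj₁ q) (proj₂ q)))

  val-injective : ∀ x (v w : Val J (proj₁ x)) → proj₁ (val x v) ≡ proj₁ (val x w) → proj₁ v ≡ proj₁ w
  val-injective x v w e = cong proj₁ (,-injectiveʳ (point-injective (cong (var x ,_) (Val-≡ {J'} e))))

open _≅_

≅-refl : ∀ {J} → J ≅ J
≅-refl = record
  { var = λ x → x ; var⁻¹ = λ x → x ; var⁻¹∘var = λ _ → refl ; var∘var⁻¹ = λ _ → refl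
  ; val = λ _ v → v ; val⁻¹ = λ _ v → v ; val⁻¹∘val = λ _ _ → refl ; val∘val⁻¹ = λ _ _ → refl
  ; R-val = λ _ _ _ _ _ → refl }

≅-sym : ∀ {J J'} → J ≅ J' → J' ≅ J
≅-sym {J} {J'} f = record
  { var = var⁻¹ f ; var⁻¹ = var f ; var⁻¹∘var = var∘var⁻¹ f ; var∘var⁻¹ = var⁻¹∘var f
  ; val = val⁻¹ f ; val⁻¹ = val f ; val⁻¹∘val = val∘val⁻¹ f ; val∘val⁻¹ = val⁻¹∘val f
  ; R-val = λ x y x≢y v w → sym (trans
      (R-val f (var⁻¹ f x) (var⁻¹ f y) (var⁻¹-≢ f x y x≢y) (val⁻¹ f x v) (val⁻¹ f y w))
      (cong₂ (λ p q → Rᵖ J' (raw {J'} p) (raw {J'} q)) (val∘val⁻¹ f x v) (val∘val⁻¹ f y w))) }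

≅-trans : ∀ {J₁ J₂ J₃} → J₁ ≅ J₂ → J₂ ≅ J₃ → J₁ ≅ J₃
≅-trans f g = record
  { var = λ x → var g (var f x) ; var⁻¹ = λ y → var⁻¹ f (var⁻¹ g y)
  ; var⁻¹∘var = λ x → trans (cong (var⁻¹ f) (var⁻¹∘var g (var f x))) (var⁻¹∘var f x)
  ; var∘var⁻¹ = λ y → trans (cong (var g) (var∘var⁻¹ f (var⁻¹ g y))) (var∘var⁻¹ g y)
  ; val = λ x v → val g (var f x) (val f x v)
  ; val⁻¹ = λ y w → val⁻¹ f (var⁻¹ g y) (val⁻¹ g y w)
  ; val⁻¹∘val = λ x v → trans (cong (point⁻¹ f) (val⁻¹∘val g (var f x) (val f x v))) (val⁻¹∘val f x v)
  ; val∘val⁻¹ = λ y w →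
      trans (cong (point g) (val∘val⁻¹ f (var⁻¹ g y) (val⁻¹ g y w))) (val∘val⁻¹ g y w)
  ; R-val = λ x y x≢y v w → trans (R-val f x y x≢y v w)
                                  (R-val g (var f x) (var f y) (var-≢ f x y x≢y) (val f x v) (val f y w)) }

≅⇒Isomorphic : ∀ {J J'} → J ≅ J' → Isomorphic J J'
≅⇒Isomorphic {J} {J'} f = varBij , valBij , R-val f
  where
  varBij = mk↔ₛ′ (var f) (var⁻¹ f) (var∘var⁻¹ f) (var⁻¹∘var f)
  valBij : (x : Var J) → Val J (proj₁ x) ↔ Val J' (proj₁ (var f x))
  valBij x = mk↔ₛ′ (val f x) back val∘back back∘val
    where
    back : Val J' (proj₁ (var f x)) → Val J (proj₁ x)
    back w = subst (Val J ∘ proj₁) (var⁻¹∘var f x) (val⁻¹ f (var f x) w)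
    back-point : ∀ w → _≡_ {A = Point J} (var⁻¹ f (var f x) , val⁻¹ f (var f x) w) (x , back w)
    back-point w = Σ-≡,≡→≡ (var⁻¹∘var f x , refl)
    val∘back : ∀ w → val f x (back w) ≡ w
    val∘back w = ,-injectiveʳ (trans (cong (point f) (sym (back-point w))) (val∘val⁻¹ f (var f x) w))
    back∘val : ∀ v → back (val f x v) ≡ v
    back∘val v = ,-injectiveʳ (trans (sym (back-point (val f x v))) (val⁻¹∘val f x v))

deleteVal-⊆ : ∀ J x v k w → T (D (deleteVal J x v) k w) → T (D J k w)
deleteVal-⊆ J x v k w p with k ≟ x
... | no _ = p
... | yes refl with w ≟ v
...   | yes _ = ⊥-elim p
...   | no _ = p

deleteVal-≢ : ∀ J x v k w → T (D (deleteVal J x v) k w) → _≢_ {A = RawPoint J} (k , w) (x , v)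
deleteVal-≢ J x v k w p refl with k ≟ x
... | no k≢x = k≢x refl
... | yes refl with w ≟ v
...   | yes _ = p
...   | no w≢v = w≢v refl

deleteVal-keep : ∀ J x v k w → T (D J k w) → _≢_ {A = RawPoint J} (k , w) (x , v) →
                 T (D (deleteVal J x v) k w)
deleteVal-keep J x v k w p kw≢xv with k ≟ x
... | no _ = p
... | yes refl with w ≟ v
...   | yes refl = kw≢xv refl
...   | no _ = p

Dominated : (J : Instance) (x : Fin (n J)) → Fin (d J x) → Fin (d J x) → Set
Dominated J x v v' =
  (y : Fin (n J)) → T (X J y) → y ≢ x →
  (vy : Fin (d J y)) → T (D J y vy) → T (R J x y v vy) → T (R J x y v' vy)

Dominated-trans : ∀ J {x u v w} → Dominated J x u v → Dominated J x v w → Dominated J x u w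
Dominated-trans J u≤v v≤w y py y≢x vy pvy = v≤w y py y≢x vy pvy ∘′ u≤v y py y≢x vy pvy

Dominated-deleteVal : ∀ J z t {x u v} → Dominated J x u v → Dominated (deleteVal J z t) x u v
Dominated-deleteVal J z t u≤v y py y≢x vy pvy = u≤v y py y≢x vy (deleteVal-⊆ J z t y vy pvy)

module _ {J : Instance} {x : Fin (n J)} {v v' : Fin (d J x)} (ns : NSubst J x v v') where

  nsVar : Var J
  nsVar = x , proj₁ ns

  nsVal nsVal' : Val J x
  nsVal = v , proj₁ (proj₂ ns)
  nsVal' = v' , proj₁ (proj₂ (proj₂ ns))

≅-NSubst : ∀ {J J'} (f : J ≅ J') {x v v'} (ns : NSubst J x v v') →
           NSubst J' (proj₁ (var f (nsVar {J} ns))) (proj₁ (val f (nsVar {J} ns) (nsVal {J} ns)))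
                     (proj₁ (val f (nsVar {J} ns) (nsVal' {J} ns)))
≅-NSubst {J} {J'} f {x} ns@(_ , _ , _ , v≢v' , v≤v') =
  proj₂ (var f x̂) , proj₂ (val f x̂ (nsVal {J} ns)) , proj₂ (val f x̂ (nsVal' {J} ns)) ,
  (λ e → v≢v' (val-injective f x̂ (nsVal {J} ns) (nsVal' {J} ns) e)) , dominated
  where
  x̂ = nsVar {J} ns
  dominated : Dominated J' (proj₁ (var f x̂)) (proj₁ (val f x̂ (nsVal {J} ns))) (proj₁ (val f x̂ (nsVal' {J} ns)))
  dominated y py y≢x w pw r =
    subst T (R-at (nsVal' {J} ns))
      (v≤v' (proj₁ ŷ) (proj₂ ŷ) ŷ≢x (proj₁ ŵ) (proj₂ ŵ) (subst T (sym (R-at (nsVal {J} ns))) r))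
    where
    ŷ = var⁻¹ f (y , py)
    ŵ = val⁻¹ f (y , py) (w , pw)
    ŷ≢x : proj₁ ŷ ≢ x
    ŷ≢x e = var⁻¹-≢ f (y , py) (var f x̂) y≢x (trans e (sym (cong proj₁ (var⁻¹∘var f x̂))))
    R-at : ∀ u → R J x (proj₁ ŷ) (proj₁ u) (proj₁ ŵ) ≡ R J' (proj₁ (var f x̂)) y (proj₁ (val f x̂ u)) w
    R-at u = trans (R-val f x̂ ŷ (≢-sym ŷ≢x) u ŵ)
                   (cong (λ p → Rᵖ J' (raw {J'} (point f (x̂ , u))) (raw {J'} p)) (val∘val⁻¹ f (y , py) (w , pw)))

≅-deleteVal : ∀ {J J'} (f : J ≅ J') (x : Var J) (v : Val J (proj₁ x)) →
  deleteVal J (proj₁ x) (proj₁ v) ≅ deleteVal J' (proj₁ (var f x)) (proj₁ (val f x v))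
≅-deleteVal {J} {J'} f x v = record
  { var = var f ; var⁻¹ = var⁻¹ f ; var⁻¹∘var = var⁻¹∘var f ; var∘var⁻¹ = var∘var⁻¹ f
  ; val = val′ ; val⁻¹ = val⁻¹′
  ; val⁻¹∘val = λ y w → raw-injective {J₋} (trans
      (cong (λ u → proj₁ (var⁻¹ f (var f y)) , proj₁ (val⁻¹ f (var f y) u)) (Val-≡ {J'} refl))
      (cong (raw {J}) (val⁻¹∘val f y (inJ w))))
  ; val∘val⁻¹ = λ y w → raw-injective {J'₋} (trans
      (cong (λ u → proj₁ (var f (var⁻¹ f y)) , proj₁ (val f (var⁻¹ f y) u)) (Val-≡ {J} refl))
      (cong (raw {J'}) (val∘val⁻¹ f y (inJ' w))))
  ; R-val = λ y z y≢z w u → R-val f y z y≢z (inJ w) (inJ u) }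
  where
  x' = proj₁ (var f x)
  v' = proj₁ (val f x v)
  J₋ = deleteVal J (proj₁ x) (proj₁ v)
  J'₋ = deleteVal J' x' v'

  inJ : ∀ {y} → Val J₋ y → Val J y
  inJ {y} (w , p) = w , deleteVal-⊆ J (proj₁ x) (proj₁ v) y w p

  inJ' : ∀ {y} → Val J'₋ y → Val J' y
  inJ' {y} (w , p) = w , deleteVal-⊆ J' x' v' y w p

  val′ : (y : Var J₋) → Val J₋ (proj₁ y) → Val J'₋ (proj₁ (var f y))
  val′ y w = proj₁ w' , deleteVal-keep J' x' v' _ _ (proj₂ w') image≢
    where
    w' = val f y (inJ w)
    image≢ : _ ≢ _
    image≢ e = deleteVal-≢ J (proj₁ x) (proj₁ v) (proj₁ y) (proj₁ w) (proj₂ w)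
                 (cong (raw {J}) (point-injective f (raw-injective {J'} e)))

  val⁻¹′ : (y : Var J'₋) → Val J'₋ (proj₁ y) → Val J₋ (proj₁ (var⁻¹ f y))
  val⁻¹′ y w = proj₁ w' , deleteVal-keep J (proj₁ x) (proj₁ v) _ _ (proj₂ w') image≢
    where
    w' = val⁻¹ f y (inJ' w)
    image≢ : _ ≢ _
    image≢ e = deleteVal-≢ J' x' v' (proj₁ y) (proj₁ w) (proj₂ w)
                 (cong (raw {J'}) (trans (sym (val∘val⁻¹ f y (inJ' w))) (cong (point f) (raw-injective {J} e))))

Domains : Instance → Set
Domains J = (k : Fin (n J)) → Fin (d J k) → Bool

withDomains : (J : Instance) → Domains J → Instance
withDomains J D′ = record J { D = D′ }

relabel-≅ : (J : Instance) (D₁ D₂ : Domains J) (σ σ⁻¹ : ∀ k → Fin (d J k) → Fin (d J k)) →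
  (∀ k u → σ⁻¹ k (σ k u) ≡ u) → (∀ k u → σ k (σ⁻¹ k u) ≡ u) →
  (∀ k u → T (D₁ k u) → T (D₂ k (σ k u))) →
  (∀ k u → T (D₂ k u) → T (D₁ k (σ⁻¹ k u))) →
  (∀ k l → k ≢ l → T (X J k) → T (X J l) → ∀ u u' → T (D₁ k u) → T (D₁ l u') →
     R J k l u u' ≡ R J k l (σ k u) (σ l u')) →
  withDomains J D₁ ≅ withDomains J D₂
relabel-≅ J D₁ D₂ σ σ⁻¹ σ⁻¹∘σ σ∘σ⁻¹ σ-active σ⁻¹-active R-σ = record
  { var = λ x → x ; var⁻¹ = λ x → x ; var⁻¹∘var = λ _ → refl ; var∘var⁻¹ = λ _ → refl
  ; val = λ (x , _) (u , p) → σ x u , σ-active x u p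
  ; val⁻¹ = λ (x , _) (u , p) → σ⁻¹ x u , σ⁻¹-active x u p
  ; val⁻¹∘val = λ x u → cong (x ,_) (Val-≡ {withDomains J D₁} (σ⁻¹∘σ (proj₁ x) (proj₁ u)))
  ; val∘val⁻¹ = λ x u → cong (x ,_) (Val-≡ {withDomains J D₂} (σ∘σ⁻¹ (proj₁ x) (proj₁ u)))
  ; R-val = λ (x , px) (y , py) x≢y (u , pu) (w , pw) → R-σ x y x≢y px py u w pu pw }

deleteVal-comm : ∀ J x v y w → deleteVal (deleteVal J x v) y w ≅ deleteVal (deleteVal J y w) x v
deleteVal-comm J x v y w =
  relabel-≅ J _ _ (λ _ u → u) (λ _ u → u) (λ _ _ → refl) (λ _ _ → refl)
    (swapped x v y w) (swapped y w x v) (λ _ _ _ _ _ _ _ _ _ → refl)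
  where
  swapped : ∀ x v y w k u → T (D (deleteVal (deleteVal J x v) y w) k u) → T (D (deleteVal (deleteVal J y w) x v) k u)
  swapped x v y w k u p = deleteVal-keep (deleteVal J y w) x v k u
      (deleteVal-keep J y w k u (deleteVal-⊆ J x v k u p′) (deleteVal-≢ (deleteVal J x v) y w k u p))
      (deleteVal-≢ J x v k u p′)
    where p′ = deleteVal-⊆ (deleteVal J x v) y w k u p

atVar : (J : Instance) (x : Fin (n J)) → (Fin (d J x) → Fin (d J x)) → ∀ k → Fin (d J k) → Fin (d J k)
atVar J x τ k u with k ≟ x
... | yes refl = τ u
... | no _ = u

atVar-inverse : ∀ J x {τ τ⁻¹} → (∀ u → τ⁻¹ (τ u) ≡ u) → ∀ k u → atVar J x τ⁻¹ k (atVar J x τ k u) ≡ u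
atVar-inverse J x τ⁻¹∘τ k u with k ≟ x
... | yes refl = τ⁻¹∘τ u
... | no _ = refl

atVar-here : ∀ J x τ u → atVar J x τ x u ≡ τ u
atVar-here J x τ u with x ≟ x
... | yes refl = refl
... | no x≢x = ⊥-elim (x≢x refl)

atVar-elsewhere : ∀ J x τ {k} u → k ≢ x → atVar J x τ k u ≡ u
atVar-elsewhere J x τ {k} u k≢x with k ≟ x
... | yes k≡x = ⊥-elim (k≢x k≡x)
... | no _ = refl

transpose-cases : ∀ {m} (v w u : Fin m) →
  (u ≡ v × transpose v w u ≡ w) ⊎ (u ≡ w × transpose v w u ≡ v) ⊎ (u ≢ v × u ≢ w × transpose v w u ≡ u)
transpose-cases v w u with u ≟ v
... | yes u≡v = inj₁ (u≡v , refl)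
... | no u≢v with u ≟ w
...   | yes u≡w = inj₂ (inj₁ (u≡w , refl))
...   | no u≢w = inj₂ (inj₂ (u≢v , u≢w , refl))

transpose-matchˡ : ∀ {m} (v w : Fin m) → transpose v w v ≡ w
transpose-matchˡ v w with v ≟ v
... | yes _ = refl
... | no v≢v = ⊥-elim (v≢v refl)

transpose-other : ∀ {m} {v w u : Fin m} → u ≢ v → u ≢ w → transpose v w u ≡ u
transpose-other {v = v} {w} {u} u≢v u≢w with transpose-cases v w u
... | inj₁ (u≡v , _) = ⊥-elim (u≢v u≡v)
... | inj₂ (inj₁ (u≡w , _)) = ⊥-elim (u≢w u≡w)
... | inj₂ (inj₂ (_ , _ , t≡u)) = t≡u

module _ (J : Instance) (x : Fin (n J)) (v w : Fin (d J x)) where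

  transpose-deleteVal : T (D J x v) → v ≢ w → ∀ k u →
    T (D (deleteVal J x v) k u) → T (D (deleteVal J x w) k (atVar J x (transpose v w) k u))
  transpose-deleteVal pv v≢w k u p = byVar (k ≟ x)
    where
    kept : ∀ {t} → t ≡ atVar J x (transpose v w) k u → T (D (deleteVal J x w) k t) →
           T (D (deleteVal J x w) k (atVar J x (transpose v w) k u))
    kept = subst (T ∘ D (deleteVal J x w) k)
    byVar : Dec (k ≡ x) → T (D (deleteVal J x w) k (atVar J x (transpose v w) k u))
    byVar (no k≢x) = kept (sym (atVar-elsewhere J x (transpose v w) u k≢x))
                          (deleteVal-keep J x w k u (deleteVal-⊆ J x v k u p) (k≢x ∘ ,-injectiveˡ))
    byVar (yes refl) with transpose-cases v w u
    ... | inj₁ (refl , _) = ⊥-elim (deleteVal-≢ J x v x u p refl)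
    ... | inj₂ (inj₁ (refl , t≡v)) = kept (trans (sym t≡v) (sym (atVar-here J x (transpose v w) u)))
                                          (deleteVal-keep J x w x v pv (v≢w ∘ ,-injectiveʳ))
    ... | inj₂ (inj₂ (_ , u≢w , t≡u)) = kept (trans (sym t≡u) (sym (atVar-here J x (transpose v w) u)))
                                            (deleteVal-keep J x w x u (deleteVal-⊆ J x v x u p) (u≢w ∘ ,-injectiveʳ))

  module _ (sameRow : ∀ l → l ≢ x → T (X J l) → ∀ u' → T (D J l u') → R J x l v u' ≡ R J x l w u') where

    transpose-R : ∀ l → l ≢ x → T (X J l) → ∀ u u' → T (D J l u') →
                  R J x l u u' ≡ R J x l (transpose v w u) u'
    transpose-R l l≢x pl u u' pu' with transpose-cases v w u
    ... | inj₁ (refl , t≡w) = trans (sameRow l l≢x pl u' pu') (cong (λ t → R J x l t u') (sym t≡w))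
    ... | inj₂ (inj₁ (refl , t≡v)) = trans (sym (sameRow l l≢x pl u' pu')) (cong (λ t → R J x l t u') (sym t≡v))
    ... | inj₂ (inj₂ (_ , _ , t≡u)) = cong (λ t → R J x l t u') (sym t≡u)

    atVar-transpose-R : ∀ k l → k ≢ l → T (X J k) → T (X J l) → ∀ u u' →
      T (D J k u) → T (D J l u') →
      R J k l u u' ≡ R J k l (atVar J x (transpose v w) k u) (atVar J x (transpose v w) l u')
    atVar-transpose-R k l k≢l pk pl u u' pu pu' with k ≟ x | l ≟ x
    ... | yes refl | yes refl = ⊥-elim (k≢l refl)
    ... | yes refl | no l≢x = transpose-R l l≢x pl u u' pu'
    ... | no k≢x | yes refl = begin
      R J k x u u'                       ≡⟨ R-sym J k x k≢l u u' ⟩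
      R J x k u' u                       ≡⟨ transpose-R k k≢x pk u' u pu ⟩
      R J x k (transpose v w u') u       ≡⟨ sym (R-sym J k x k≢l u _) ⟩
      R J k x u (transpose v w u')       ∎
      where open ≡-Reasoning
    ... | no _ | no _ = refl

deleteVal-transpose-≅ : ∀ J x v w → NSubst J x v w → NSubst J x w v → deleteVal J x v ≅ deleteVal J x w
deleteVal-transpose-≅ J x v w (_ , pv , pw , v≢w , v≤w) (_ , _ , _ , _ , w≤v) =
  relabel-≅ J _ _ (atVar J x (transpose v w)) (atVar J x (transpose w v))
    (atVar-inverse J x (λ _ → transpose-inverse w v)) (atVar-inverse J x (λ _ → transpose-inverse v w))
    (transpose-deleteVal J x v w pv v≢w) (transpose-deleteVal J x w v pw (≢-sym v≢w))
    (λ k l k≢l pk pl u u' pu pu' → atVar-transpose-R J x v w sameRow k l k≢l pk pl u u'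
       (deleteVal-⊆ J x v k u pu) (deleteVal-⊆ J x v l u' pu'))
  where
  sameRow : ∀ l → l ≢ x → T (X J l) → ∀ u' → T (D J l u') → R J x l v u' ≡ R J x l w u'
  sameRow l l≢x pl u' pu' = T-extensional (v≤w l pl l≢x u' pu') (w≤v l pl l≢x u' pu')

-- Local confluence of NS deletions

Substitutable : (J : Instance) (x : Fin (n J)) → Fin (d J x) → Set
Substitutable J x v = Σ (Fin (d J x)) (NSubst J x v)

samePoint? : ∀ J x v y w → Dec (_≡_ {A = RawPoint J} (x , v) (y , w))
samePoint? J x v y w = ≡-dec _≟_ _≟_ (x , v) (y , w)

-- w keeps its substitute b unless b is the deleted v; then the substitute a of v takes over.
NSubst-deleteVal : ∀ J {x v a y w b} → NSubst J x v a → NSubst J y w b →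
  _≢_ {A = RawPoint J} (y , w) (x , v) →
  ¬ (_≡_ {A = RawPoint J} (y , b) (x , v) × _≡_ {A = RawPoint J} (x , a) (y , w)) →
  Substitutable (deleteVal J x v) y w
NSubst-deleteVal J {x} {v} {a} {y} {w} {b} (_ , _ , pa , v≢a , v≤a) (py , pw , pb , w≢b , w≤b) yw≢xv ¬both
  with samePoint? J y b x v
... | no yb≢xv =
  b , py , deleteVal-keep J x v y w pw yw≢xv , deleteVal-keep J x v y b pb yb≢xv , w≢b ,
  Dominated-deleteVal J x v w≤b
... | yes refl =
  a , py , deleteVal-keep J x v x w pw yw≢xv , deleteVal-keep J x v x a pa (v≢a ∘ sym ∘ ,-injectiveʳ) ,
  (λ w≡a → ¬both (refl , cong (x ,_) (sym w≡a))) ,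
  Dominated-deleteVal J x v (Dominated-trans J w≤b v≤a)

Joinable : (J : Instance) (x : Fin (n J)) (v : Fin (d J x)) (y : Fin (n J)) (w : Fin (d J y)) → Set
Joinable J x v y w =
  (deleteVal J x v ≅ deleteVal J y w) ⊎
  (Substitutable (deleteVal J x v) y w × Substitutable (deleteVal J y w) x v)

NSubst-joinable : ∀ J {x v a y w b} → NSubst J x v a → NSubst J y w b → Joinable J x v y w
NSubst-joinable J {x} {v} {a} {y} {w} {b} ns₁ ns₂ with samePoint? J x v y w
... | yes refl = inj₁ ≅-refl
... | no xv≢yw with samePoint? J y b x v ×-dec samePoint? J x a y w
...   | yes (refl , refl) = inj₁ (deleteVal-transpose-≅ J x v w ns₁ ns₂)
...   | no ¬both = inj₂ (NSubst-deleteVal J ns₁ ns₂ (≢-sym xv≢yw) ¬both ,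
                          NSubst-deleteVal J ns₂ ns₁ xv≢yw (¬both ∘ λ (p , q) → q , p))

-- Existence and uniqueness of NS-closures

∑ : ∀ {m} → (Fin m → ℕ) → ℕ
∑ {zero} f = 0
∑ {suc m} f = f zero + ∑ (f ∘ suc)

∑-mono-≤ : ∀ {m} {f g : Fin m → ℕ} → (∀ k → f k ≤ g k) → ∑ f ≤ ∑ g
∑-mono-≤ {zero} f≤g = z≤n
∑-mono-≤ {suc m} f≤g = +-mono-≤ (f≤g zero) (∑-mono-≤ (f≤g ∘ suc))

∑-mono-< : ∀ {m} {f g : Fin m → ℕ} → (∀ k → f k ≤ g k) → ∀ k → f k < g k → ∑ f < ∑ g
∑-mono-< f≤g zero f<g = +-mono-<-≤ f<g (∑-mono-≤ (f≤g ∘ suc))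
∑-mono-< f≤g (suc k) f<g = +-mono-≤-< (f≤g zero) (∑-mono-< (f≤g ∘ suc) k f<g)

indicator : Bool → ℕ
indicator b = if b then 1 else 0

indicator-mono : ∀ {a b} → (T a → T b) → indicator a ≤ indicator b
indicator-mono {false} _ = z≤n
indicator-mono {true} {false} a⇒b = ⊥-elim (a⇒b tt)
indicator-mono {true} {true} _ = s≤s z≤n

indicator-< : ∀ {a b} → ¬ T a → T b → indicator a < indicator b
indicator-< {true} ¬a _ = ⊥-elim (¬a tt)
indicator-< {false} {true} _ _ = s≤s z≤n

size : Instance → ℕ
size J = ∑ λ k → ∑ λ w → indicator (D J k w)

size-deleteVal : ∀ J x v → T (D J x v) → size (deleteVal J x v) < size J
size-deleteVal J x v pv =
  ∑-mono-< (λ k → ∑-mono-≤ (λ w → indicator-mono (deleteVal-⊆ J x v k w))) x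
    (∑-mono-< (λ w → indicator-mono (deleteVal-⊆ J x v x w)) v
      (indicator-< (λ p → deleteVal-≢ J x v x v p refl) pv))

Dominated? : ∀ J x v v' → Dec (Dominated J x v v')
Dominated? J x v v' =
  all? λ y → T? (X J y) →-dec (¬? (y ≟ x) →-dec all? λ vy →
    T? (D J y vy) →-dec (T? (R J x y v vy) →-dec T? (R J x y v' vy)))

NSubst? : ∀ J x v v' → Dec (NSubst J x v v')
NSubst? J x v v' =
  T? (X J x) ×-dec T? (D J x v) ×-dec T? (D J x v') ×-dec ¬? (v ≟ v') ×-dec Dominated? J x v v'

someSubstitutable? : ∀ J → Dec (Σ[ x ∈ Fin (n J) ] Σ[ v ∈ Fin (d J x) ] Substitutable J x v)
someSubstitutable? J = any? λ x → any? λ v → any? λ v' → NSubst? J x v v'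

NS-closure : ∀ J → Σ Instance (IsNS J)
NS-closure J = go J (<-wellFounded (size J))
  where
  go : ∀ J → Acc _<_ (size J) → Σ Instance (IsNS J)
  go J (acc smaller) with someSubstitutable? J
  ... | no none = J , ε , λ x v v' ns → none (x , v , v' , ns)
  ... | yes (x , v , v' , ns) with go (deleteVal J x v) (smaller (size-deleteVal J x v (proj₁ (proj₂ ns))))
  ...   | K , path , irreducible = K , step x v v' ns ◅ path , irreducible

IsNS-◅◅ : ∀ {J J' K} → Star NSStep J J' → IsNS J' K → IsNS J K
IsNS-◅◅ path (path' , irreducible) = path ◅◅ path' , irreducible

shrink : ∀ {N} J {x v v'} → NSubst J x v v' → size J < suc N → size (deleteVal J x v) < N
shrink J {x} {v} ns bound = <-≤-trans (size-deleteVal J x v (proj₁ (proj₂ ns))) (s≤s⁻¹ bound)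

NS-≅-bounded : ∀ N {J J' K K'} → size J < N → size J' < N → J ≅ J' → IsNS J K → IsNS J' K' → K ≅ K'
NS-≅-bounded zero () _ _ _ _
NS-≅-bounded (suc N) _ _ f (ε , _) (ε , _) = f
NS-≅-bounded (suc N) _ _ f (ε , irreducible) (step _ _ _ ns' ◅ _ , _) =
  ⊥-elim (irreducible _ _ _ (≅-NSubst (≅-sym f) ns'))
NS-≅-bounded (suc N) _ _ f (step _ _ _ ns ◅ _ , _) (ε , irreducible') =
  ⊥-elim (irreducible' _ _ _ (≅-NSubst f ns))
NS-≅-bounded (suc N) {J} {J'} {K} {K'} bJ bJ' f
  (step x v v' ns ◅ path , irreducible) (step y w w' ns' ◅ path' , irreducible') =
  rejoin (NSubst-joinable J' nsᶠ ns')
  where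
  x̂ = nsVar {J} ns
  v̂ = nsVal {J} ns
  xᶠ = proj₁ (var f x̂)
  vᶠ = proj₁ (val f x̂ v̂)
  nsᶠ = ≅-NSubst f ns
  bJ₋ = shrink J ns bJ
  bJ'₋ = shrink J' ns' bJ'
  bJ'ᶠ = shrink J' nsᶠ bJ'
  rejoin : Joinable J' xᶠ vᶠ y w → K ≅ K'
  rejoin (inj₁ g) =
    NS-≅-bounded N bJ₋ bJ'₋ (≅-trans (≅-deleteVal f x̂ v̂) g) (path , irreducible) (path' , irreducible')
  rejoin (inj₂ ((b , ns₁) , (a , ns₂))) with NS-closure (deleteVal (deleteVal J' xᶠ vᶠ) y w)
                                        | NS-closure (deleteVal (deleteVal J' y w) xᶠ vᶠ)
  ... | K₁ , path₁ , irreducible₁ | K₂ , path₂ , irreducible₂ =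
    ≅-trans K≅K₁ (≅-trans K₁≅K₂ K₂≅K')
    where
    K≅K₁ : K ≅ K₁
    K≅K₁ = NS-≅-bounded N bJ₋ bJ'ᶠ (≅-deleteVal f x̂ v̂)
             (path , irreducible) (step y w b ns₁ ◅ path₁ , irreducible₁)
    K₁≅K₂ : K₁ ≅ K₂
    K₁≅K₂ = NS-≅-bounded N
              (<-trans (size-deleteVal (deleteVal J' xᶠ vᶠ) y w (proj₁ (proj₂ ns₁))) bJ'ᶠ)
              (<-trans (size-deleteVal (deleteVal J' y w) xᶠ vᶠ (proj₁ (proj₂ ns₂))) bJ'₋)
              (deleteVal-comm J' xᶠ vᶠ y w) (path₁ , irreducible₁) (path₂ , irreducible₂)
    K₂≅K' : K₂ ≅ K'
    K₂≅K' = NS-≅-bounded N bJ'₋ bJ'₋ ≅-refl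
              (step xᶠ vᶠ a ns₂ ◅ path₂ , irreducible₂) (path' , irreducible')

NS-≅ : ∀ {J J' K K'} → J ≅ J' → IsNS J K → IsNS J' K' → K ≅ K'
NS-≅ {J} {J'} = NS-≅-bounded (suc (size J + size J')) (s≤s (m≤m+n _ _)) (s≤s (m≤n+m _ _))

-- Pruning a set of dominated values

module Prune (J : Instance) (x : Fin (n J)) (px : T (X J x)) (S : Fin (d J x) → Bool)
  (escape : ∀ u → T (D J x u) → T (S u) →
            Σ[ u' ∈ Fin (d J x) ] T (D J x u') × ¬ T (S u') × Dominated J x u u') where

  prune : Domains J → List (Fin (d J x)) → Domains J
  prune DD [] = DD
  prune DD (u ∷ us) = prune (if DD x u ∧ S u then D (deleteVal (withDomains J DD) x u) else DD) us

  Invariant : Domains J → Set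
  Invariant DD = (∀ k w → T (DD k w) → T (D J k w)) × (∀ w → T (D J x w) → ¬ T (S w) → T (DD x w))

  private
    S-≢ : ∀ {u w} → T (S u) → ¬ T (S w) → _≢_ {A = RawPoint J} (x , w) (x , u)
    S-≢ su ¬sw e = ¬sw (subst (T ∘ S) (sym (,-injectiveʳ e)) su)

  invariant-deleteVal : ∀ DD u → T (S u) → Invariant DD → Invariant (D (deleteVal (withDomains J DD) x u))
  invariant-deleteVal DD u su (⊆J , keeps) =
    (λ k w p → ⊆J k w (deleteVal-⊆ (withDomains J DD) x u k w p)) ,
    (λ w pw ¬sw → deleteVal-keep (withDomains J DD) x u x w (keeps w pw ¬sw) (S-≢ su ¬sw))

  NSubst-prune : ∀ DD u → Invariant DD → T (DD x u) → T (S u) → Substitutable (withDomains J DD) x u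
  NSubst-prune DD u (⊆J , keeps) pu su with escape u (⊆J x u pu) su
  ... | u' , pu' , ¬su' , u≤u' =
    u' , px , pu , keeps u' pu' ¬su' , (λ u≡u' → ¬su' (subst (T ∘ S) u≡u' su)) ,
    (λ y py y≢x vy pvy → u≤u' y py y≢x vy (⊆J y vy pvy))

  prune-path : ∀ DD us → Invariant DD → Star NSStep (withDomains J DD) (withDomains J (prune DD us))
  prune-path DD [] _ = ε
  prune-path DD (u ∷ us) inv with DD x u ∧ S u in eq
  ... | false = prune-path DD us inv
  ... | true = step x u (proj₁ sub) (proj₂ sub) ◅ prune-path _ us (invariant-deleteVal DD u su inv)
    where
    marked = subst T (sym eq) tt
    su = T-∧ʳ {DD x u} marked
    sub = NSubst-prune DD u inv (T-∧ˡ marked) su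

  prune-⊆ : ∀ DD us k w → T (prune DD us k w) → T (DD k w)
  prune-⊆ DD [] k w p = p
  prune-⊆ DD (u ∷ us) k w p with DD x u ∧ S u
  ... | true = deleteVal-⊆ (withDomains J DD) x u k w (prune-⊆ _ us k w p)
  ... | false = prune-⊆ DD us k w p

  prune-keep-elsewhere : ∀ DD us k w → k ≢ x → T (DD k w) → T (prune DD us k w)
  prune-keep-elsewhere DD [] k w _ p = p
  prune-keep-elsewhere DD (u ∷ us) k w k≢x p with DD x u ∧ S u
  ... | true = prune-keep-elsewhere _ us k w k≢x (deleteVal-keep (withDomains J DD) x u k w p (k≢x ∘ ,-injectiveˡ))
  ... | false = prune-keep-elsewhere DD us k w k≢x p

  prune-keep : ∀ DD us w → ¬ T (S w) → T (DD x w) → T (prune DD us x w)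
  prune-keep DD [] w _ p = p
  prune-keep DD (u ∷ us) w ¬sw p with DD x u ∧ S u in eq
  ... | true = prune-keep _ us w ¬sw (deleteVal-keep (withDomains J DD) x u x w p (S-≢ su ¬sw))
    where su = T-∧ʳ {DD x u} (subst T (sym eq) tt)
  ... | false = prune-keep DD us w ¬sw p

  prune-drop : ∀ DD us w → w ∈ us → T (S w) → ¬ T (prune DD us x w)
  prune-drop DD (u ∷ us) .u (here refl) su p with DD x u ∧ S u in eq
  ... | true = deleteVal-≢ (withDomains J DD) x u x u (prune-⊆ _ us x u p) refl
  ... | false = subst T eq (T-∧⁺ (prune-⊆ DD us x u p) su)
  prune-drop DD (u ∷ us) w (there w∈us) su p with DD x u ∧ S u
  ... | true = prune-drop _ us w w∈us su p
  ... | false = prune-drop DD us w w∈us su p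

  pruned : Instance
  pruned = withDomains J (prune (D J) (allFin (d J x)))

  pruned-path : Star NSStep J pruned
  pruned-path = prune-path (D J) (allFin (d J x)) ((λ _ _ p → p) , (λ _ p _ → p))

  pruned-⊆ : ∀ k w → T (D pruned k w) → T (D J k w)
  pruned-⊆ = prune-⊆ (D J) (allFin (d J x))

  pruned-keep-elsewhere : ∀ k w → k ≢ x → T (D J k w) → T (D pruned k w)
  pruned-keep-elsewhere = prune-keep-elsewhere (D J) (allFin (d J x))

  pruned-keep : ∀ w → ¬ T (S w) → T (D J x w) → T (D pruned x w)
  pruned-keep = prune-keep (D J) (allFin (d J x))

  pruned-drop : ∀ w → T (S w) → ¬ T (D pruned x w)
  pruned-drop w = prune-drop (D J) (allFin (d J x)) w (∈-allFin w)

module PointBijection (J J' : Instance)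
  (F : Var J → Var J') (F⁻¹ : Var J' → Var J)
  (F⁻¹∘F : ∀ x → F⁻¹ (F x) ≡ x) (F∘F⁻¹ : ∀ y → F (F⁻¹ y) ≡ y)
  (e : Point J → RawPoint J')
  (e-var : ∀ p → proj₁ (e p) ≡ proj₁ (F (proj₁ p)))
  (e-active : ∀ p → Active J' (e p))
  (e-injective : ∀ {p q} → e p ≡ e q → p ≡ q)
  (e-surjective : ∀ q → Σ[ p ∈ Point J ] e p ≡ raw {J'} q)
  (e-R : ∀ p q → proj₁ (e p) ≢ proj₁ (e q) → Rᵖ J (raw {J} p) (raw {J} q) ≡ Rᵖ J' (e p) (e q))
  where

  private
    valᵉ : (x : Var J) → Val J (proj₁ x) → Val J' (proj₁ (F x))
    valᵉ x v = subst (Fin ∘ d J') (e-var (x , v)) (proj₂ (e (x , v))) ,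
               subst (Active J') (Σ-≡,≡→≡ (e-var (x , v) , refl)) (e-active (x , v))

    valᵉ-raw : ∀ x v → raw {J'} (F x , valᵉ x v) ≡ e (x , v)
    valᵉ-raw x v = sym (Σ-≡,≡→≡ (e-var (x , v) , refl))

    preimage-var : ∀ y w → proj₁ (proj₁ (e-surjective (y , w))) ≡ F⁻¹ y
    preimage-var y w = begin
      proj₁ p                ≡⟨ sym (F⁻¹∘F _) ⟩
      F⁻¹ (F (proj₁ p))      ≡⟨ cong F⁻¹ (Var-≡ {J'} (trans (sym (e-var p)) (cong proj₁ hit))) ⟩
      F⁻¹ y                  ∎
      where
      open ≡-Reasoning
      p = proj₁ (e-surjective (y , w))
      hit = proj₂ (e-surjective (y , w))

    valᵉ⁻¹ : (y : Var J') → Val J' (proj₁ y) → Val J (proj₁ (F⁻¹ y))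
    valᵉ⁻¹ y w = subst (Val J ∘ proj₁) (preimage-var y w) (proj₂ (proj₁ (e-surjective (y , w))))

    preimage : ∀ y w → proj₁ (e-surjective (y , w)) ≡ (F⁻¹ y , valᵉ⁻¹ y w)
    preimage y w = Σ-≡,≡→≡ (preimage-var y w , refl)

    ≢-var : ∀ x y → proj₁ x ≢ proj₁ y → ∀ v w → proj₁ (e (x , v)) ≢ proj₁ (e (y , w))
    ≢-var x y x≢y v w eq = x≢y (cong proj₁ (begin
      x              ≡⟨ sym (F⁻¹∘F x) ⟩
      F⁻¹ (F x)      ≡⟨ cong F⁻¹ (Var-≡ {J'} (trans (sym (e-var (x , v))) (trans eq (e-var (y , w))))) ⟩
      F⁻¹ (F y)      ≡⟨ F⁻¹∘F y ⟩
      y              ∎))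
      where open ≡-Reasoning

  ≅-pointBijection : J ≅ J'
  ≅-pointBijection = record
    { var = F ; var⁻¹ = F⁻¹ ; var⁻¹∘var = F⁻¹∘F ; var∘var⁻¹ = F∘F⁻¹
    ; val = valᵉ ; val⁻¹ = valᵉ⁻¹
    ; val⁻¹∘val = λ x v → e-injective (begin
        e (F⁻¹ (F x) , valᵉ⁻¹ (F x) (valᵉ x v))   ≡⟨ cong e (sym (preimage (F x) (valᵉ x v))) ⟩
        e (proj₁ (e-surjective (F x , valᵉ x v)))  ≡⟨ proj₂ (e-surjective (F x , valᵉ x v)) ⟩
        raw {J'} (F x , valᵉ x v)                  ≡⟨ valᵉ-raw x v ⟩
        e (x , v)                                  ∎)
    ; val∘val⁻¹ = λ y w → raw-injective {J'} (begin
        raw {J'} (F (F⁻¹ y) , valᵉ (F⁻¹ y) (valᵉ⁻¹ y w))  ≡⟨ valᵉ-raw (F⁻¹ y) (valᵉ⁻¹ y w) ⟩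
        e (F⁻¹ y , valᵉ⁻¹ y w)                           ≡⟨ cong e (sym (preimage y w)) ⟩
        e (proj₁ (e-surjective (y , w)))                 ≡⟨ proj₂ (e-surjective (y , w)) ⟩
        raw {J'} (y , w)                                 ∎)
    ; R-val = λ x y x≢y v w → trans (e-R (x , v) (y , w) (≢-var x y x≢y v w))
                                    (cong₂ (Rᵖ J') (sym (valᵉ-raw x v)) (sym (valᵉ-raw y w))) }
    where open ≡-Reasoning

-- Elimination under the triangle property

Supports : (I : Instance) (m q : Fin (n I)) → Fin (d I q) → Set
Supports I m q v = Σ[ u ∈ Fin (d I m) ] T (D I m u) × T (R I q m v u)

elim-⊆ : ∀ I m q v → T (D (elim I m) q v) → T (D I q v)
elim-⊆ I m q v = T-∧ˡ

elim-Supports : ∀ I m q v → q ≢ m → T (D (elim I m) q v) → Supports I m q v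
elim-Supports I m q v q≢m p with Equivalence.to T-∨ (T-∧ʳ {D I q v} p)
... | inj₁ q≡m = ⊥-elim (q≢m (toWitness q≡m))
... | inj₂ supported with satisfied (any⁻ _ (allFin (d I m)) supported)
...   | u , pu∧r = u , T-∧ˡ pu∧r , T-∧ʳ pu∧r

elim-keep : ∀ I m q v → T (D I q v) → Supports I m q v → T (D (elim I m) q v)
elim-keep I m q v pv (u , pu , r) =
  T-∧⁺ pv (Equivalence.from T-∨ (inj₂ (any⁺ _ (lose (∈-allFin u) (T-∧⁺ pu r)))))

TriangleJustifies-Supports : ∀ I {i j} → TriangleJustifies I i j →
  ∀ q → T (X I q) → q ≢ i → q ≢ j → ∀ v → T (D I q v) → Supports I i q v → Supports I j q v
TriangleJustifies-Supports I {i} {j} tij q pq q≢i q≢j v pv (u , pu , r) with tij u pu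
... | w , pw , _ , triangle =
  w , pw , subst T (sym (R-sym I q j q≢j v w)) (triangle q pq q≢j q≢i v pv (subst T (R-sym I q i q≢i v u) r))

elim-transfer : ∀ I {i j} → TriangleJustifies I i j →
  ∀ q → T (X I q) → q ≢ i → q ≢ j → ∀ v → T (D (elim I i) q v) → T (D (elim I j) q v)
elim-transfer I {i} {j} tij q pq q≢i q≢j v p =
  elim-keep I j q v (elim-⊆ I i q v p)
    (TriangleJustifies-Supports I tij q pq q≢i q≢j v (elim-⊆ I i q v p) (elim-Supports I i q v q≢i p))

-- The merged instance

module Merge (I : Instance) (i j : Fin (n I)) (pi : T (X I i)) (pj : T (X I j)) (i≢j : i ≢ j)
             (tij : TriangleJustifies I i j) (tji : TriangleJustifies I j i) where

  -- Variable k of the merged instance has values Fin (d I k + d I i): the left block holds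
  -- the values of xₖ, the right block copies of the values of xᵢ, active only at k = j.
  Block : Fin (n I) → Set
  Block k = Fin (d I k) ⊎ Fin (d I i)

  sourceᵇ : ∀ k → Block k → RawPoint I
  sourceᵇ k (inj₁ a) = k , a
  sourceᵇ k (inj₂ u) = i , u

  source : ∀ k → Fin (d I k + d I i) → RawPoint I
  source k v = sourceᵇ k (splitAt (d I k) v)

  activeᵇ : ∀ k → Block k → Bool
  activeᵇ k (inj₁ a) = D (elim I i) k a
  activeᵇ k (inj₂ u) = ⌊ k ≟ j ⌋ ∧ D (elim I j) i u

  isOwn : ∀ {k} → Block k → Bool
  isOwn (inj₁ _) = true
  isOwn (inj₂ _) = false

  -- False within one variable of I, so that R stays symmetric between the copies of xᵢ at j
  -- and the deleted variable i.
  Rˢ : RawPoint I → RawPoint I → Bool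
  Rˢ (k , a) (l , b) = if ⌊ k ≟ l ⌋ then false else R I k l a b

  Rˢ-sym : ∀ p q → Rˢ p q ≡ Rˢ q p
  Rˢ-sym (k , a) (l , b) with k ≟ l | l ≟ k
  ... | yes _ | yes _ = refl
  ... | yes k≡l | no l≢k = ⊥-elim (l≢k (sym k≡l))
  ... | no k≢l | yes l≡k = ⊥-elim (k≢l (sym l≡k))
  ... | no k≢l | no _ = R-sym I k l k≢l a b

  Rˢ-≢ : ∀ p q → proj₁ p ≢ proj₁ q → Rˢ p q ≡ Rᵖ I p q
  Rˢ-≢ (k , a) (l , b) k≢l with k ≟ l
  ... | yes k≡l = ⊥-elim (k≢l k≡l)
  ... | no _ = refl

  merged : Instance
  merged = record
    { n = n I ; X = X (elim I i) ; d = λ k → d I k + d I i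
    ; D = λ k v → activeᵇ k (splitAt (d I k) v)
    ; R = λ k l u v → Rˢ (source k u) (source l v)
    ; R-sym = λ k l _ u v → Rˢ-sym (source k u) (source l v) }

  merged-j : T (X merged j)
  merged-j = T-∧⁺ pj (fromWitnessFalse (≢-sym i≢j))

  merged-≢i : ∀ {y} → T (X merged y) → y ≢ i
  merged-≢i {y} py = toWitnessFalse (T-∧ʳ {X I y} py)

  data ActiveView (y : Fin (n I)) (v : Fin (d I y + d I i)) : Set where
    own : ∀ a → splitAt (d I y) v ≡ inj₁ a → T (D (elim I i) y a) → ActiveView y v
    borrowed : ∀ u → y ≡ j → splitAt (d I y) v ≡ inj₂ u → T (D (elim I j) i u) → ActiveView y v

  activeView : ∀ y v → T (D merged y v) → ActiveView y v
  activeView y v p with splitAt (d I y) v in eq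
  ... | inj₁ a = own a eq p
  ... | inj₂ u = borrowed u (toWitness (T-∧ˡ {⌊ y ≟ j ⌋} p)) eq (T-∧ʳ {⌊ y ≟ j ⌋} p)

  dominated-via : ∀ u u' {P Q} → source j u ≡ P → source j u' ≡ Q →
    (proj₁ P ≡ i ⊎ proj₁ P ≡ j) → (proj₁ Q ≡ i ⊎ proj₁ Q ≡ j) →
    (∀ k → T (X I k) → k ≢ i → k ≢ j → ∀ vk → T (D I k vk) →
       T (Rᵖ I P (k , vk)) → T (Rᵖ I Q (k , vk))) →
    Dominated merged j u u'
  dominated-via u u' refl refl P∈ij Q∈ij dom y py y≢j vy pvy r with activeView y vy pvy
  ... | borrowed _ y≡j _ _ = ⊥-elim (y≢j y≡j)
  ... | own b eq pb =
    subst T (sym (R-at Q∈ij)) (dom y (T-∧ˡ py) y≢i y≢j b (elim-⊆ I i y b pb) (subst T (R-at P∈ij) r))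
    where
    y≢i = merged-≢i py
    ≢y : ∀ {k} → k ≡ i ⊎ k ≡ j → k ≢ y
    ≢y (inj₁ k≡i) k≡y = y≢i (trans (sym k≡y) k≡i)
    ≢y (inj₂ k≡j) k≡y = y≢j (trans (sym k≡y) k≡j)
    R-at : ∀ {S} → proj₁ S ≡ i ⊎ proj₁ S ≡ j → Rˢ S (source y vy) ≡ Rᵖ I S (y , b)
    R-at {S} S∈ij = trans (cong (Rˢ S ∘ sourceᵇ y) eq) (Rˢ-≢ S (y , b) (≢y S∈ij))

  ownAt borrowedAt : Fin (d merged j) → Bool
  ownAt v = isOwn (splitAt (d I j) v)
  borrowedAt v = not (ownAt v)

  escape-borrowed : ∀ u → T (D merged j u) → T (borrowedAt u) →
    Σ[ u' ∈ Fin (d merged j) ] T (D merged j u') × ¬ T (borrowedAt u') × Dominated merged j u u'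
  escape-borrowed u pu b with activeView j u pu
  ... | own a eq _ = ⊥-elim (subst (T ∘ not ∘ isOwn) eq b)
  ... | borrowed r _ eq pr with tij r (elim-⊆ I j i r pr)
  ...   | w , pw , rw , triangle =
    w ↑ˡ d I i ,
    subst (T ∘ activeᵇ j) (sym w-own) (elim-keep I i j w pw (r , elim-⊆ I j i r pr , rw)) ,
    subst (¬_ ∘ T ∘ not ∘ isOwn) (sym w-own) (λ ()) ,
    dominated-via u (w ↑ˡ d I i) (cong (sourceᵇ j) eq) (cong (sourceᵇ j) w-own) (inj₁ refl) (inj₂ refl)
      (λ k pk k≢i k≢j → triangle k pk k≢j k≢i)
    where w-own = splitAt-↑ˡ (d I j) w (d I i)

  escape-own : ∀ u → T (D merged j u) → T (ownAt u) →
    Σ[ u' ∈ Fin (d merged j) ] T (D merged j u') × ¬ T (ownAt u') × Dominated merged j u u'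
  escape-own u pu o with activeView j u pu
  ... | borrowed r _ eq _ = ⊥-elim (subst (T ∘ isOwn) eq o)
  ... | own a eq pa with tji a (elim-⊆ I i j a pa)
  ...   | r , pr , rr , triangle =
    d I j ↑ʳ r ,
    subst (T ∘ activeᵇ j) (sym r-borrowed)
      (T-∧⁺ (fromWitness {a? = j ≟ j} refl) (elim-keep I j i r pr (a , elim-⊆ I i j a pa , rr))) ,
    subst (¬_ ∘ T ∘ isOwn) (sym r-borrowed) (λ ()) ,
    dominated-via u (d I j ↑ʳ r) (cong (sourceᵇ j) eq) (cong (sourceᵇ j) r-borrowed)
      (inj₂ refl) (inj₁ refl) triangle
    where r-borrowed = splitAt-↑ʳ (d I j) (d I i) r

  module Pᵢ = Prune merged j merged-j borrowedAt escape-borrowed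
  module Pⱼ = Prune merged j merged-j ownAt escape-own

  keep-own : ∀ y a → T (X merged y) → T (D (elim I i) y a) → T (D Pᵢ.pruned y (a ↑ˡ d I i))
  keep-own y a py pa = byVar (y ≟ j)
    where
    a-own = splitAt-↑ˡ (d I y) a (d I i)
    active : T (D merged y (a ↑ˡ d I i))
    active = subst (T ∘ activeᵇ y) (sym a-own) pa
    byVar : Dec (y ≡ j) → T (D Pᵢ.pruned y (a ↑ˡ d I i))
    byVar (yes refl) = Pᵢ.pruned-keep (a ↑ˡ d I i) (subst (¬_ ∘ T ∘ not ∘ isOwn) (sym a-own) (λ ())) active
    byVar (no y≢j) = Pᵢ.pruned-keep-elsewhere y (a ↑ˡ d I i) y≢j active

  Pᵢ-own : ∀ x v → T (D Pᵢ.pruned x v) →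
           Σ[ a ∈ Fin (d I x) ] splitAt (d I x) v ≡ inj₁ a × T (D (elim I i) x a)
  Pᵢ-own x v p with activeView x v (Pᵢ.pruned-⊆ x v p)
  ... | own a eq pa = a , eq , pa
  ... | borrowed _ refl eq _ = ⊥-elim (Pᵢ.pruned-drop v (subst (T ∘ not ∘ isOwn) (sym eq) tt) p)

  Pᵢ≅elimᵢ : Pᵢ.pruned ≅ elim I i
  Pᵢ≅elimᵢ = PointBijection.≅-pointBijection Pᵢ.pruned (elim I i) id id (λ _ → refl) (λ _ → refl)
    e e-var e-active e-injective e-surjective (λ p q → Rˢ-≢ (e p) (e q))
    where
    e : Point Pᵢ.pruned → RawPoint (elim I i)
    e ((x , _) , (v , _)) = source x v

    e-own : ∀ p → e p ≡ (proj₁ (proj₁ p) , proj₁ (Pᵢ-own _ _ (proj₂ (proj₂ p))))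
    e-own ((x , _) , (v , pv)) = cong (sourceᵇ x) (proj₁ (proj₂ (Pᵢ-own x v pv)))

    e-var : ∀ p → proj₁ (e p) ≡ proj₁ (proj₁ p)
    e-var p = cong proj₁ (e-own p)

    e-active : ∀ p → Active (elim I i) (e p)
    e-active p = subst (Active (elim I i)) (sym (e-own p))
                       (proj₂ (proj₂ (Pᵢ-own _ _ (proj₂ (proj₂ p)))))

    back : RawPoint I → RawPoint merged
    back (k , a) = k , a ↑ˡ d I i

    raw≡back : ∀ p → raw {Pᵢ.pruned} p ≡ back (e p)
    raw≡back p@((x , _) , (v , pv)) =
      trans (cong (x ,_) (sym (splitAt⁻¹-↑ˡ (proj₁ (proj₂ (Pᵢ-own x v pv)))))) (cong back (sym (e-own p)))

    e-injective : ∀ {p q} → e p ≡ e q → p ≡ q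
    e-injective {p} {q} e≡ =
      raw-injective {Pᵢ.pruned} (trans (raw≡back p) (trans (cong back e≡) (sym (raw≡back q))))

    e-surjective : ∀ q → Σ[ p ∈ Point Pᵢ.pruned ] e p ≡ raw {elim I i} q
    e-surjective ((y , py) , (a , pa)) =
      ((y , py) , (a ↑ˡ d I i , keep-own y a py pa)) , cong (sourceᵇ y) (splitAt-↑ˡ (d I y) a (d I i))

  swapVar : ∀ {a b} → T (X I a) → a ≢ b → ∀ k → T (X (elim I a) k) → T (X (elim I b) (transpose b a k))
  swapVar {a} {b} pa a≢b k pk = byVar (k ≟ b)
    where
    byVar : Dec (k ≡ b) → T (X (elim I b) (transpose b a k))
    byVar (yes refl) = subst (T ∘ X (elim I k)) (sym (transpose-matchˡ k a)) (T-∧⁺ pa (fromWitnessFalse a≢b))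
    byVar (no k≢b) = subst (T ∘ X (elim I b)) (sym (transpose-other k≢b (toWitnessFalse (T-∧ʳ {X I k} pk))))
                           (T-∧⁺ {X I k} (T-∧ˡ {X I k} pk) (fromWitnessFalse {a? = k ≟ b} k≢b))

  toⱼ : Var merged → Var (elim I j)
  toⱼ (k , pk) = transpose j i k , swapVar pi i≢j k pk

  fromⱼ : Var (elim I j) → Var merged
  fromⱼ (k , pk) = transpose i j k , swapVar pj (≢-sym i≢j) k pk

  data PⱼView (x : Fin (n I)) (v : Fin (d I x + d I i)) : Set where
    borrowedⱼ : ∀ r → x ≡ j → splitAt (d I x) v ≡ inj₂ r → T (D (elim I j) i r) → PⱼView x v
    ownⱼ : ∀ a → x ≢ j → splitAt (d I x) v ≡ inj₁ a → T (D (elim I j) x a) → PⱼView x v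

  Pⱼ-view : ∀ x v → T (X merged x) → T (D Pⱼ.pruned x v) → PⱼView x v
  Pⱼ-view x v px p with activeView x v (Pⱼ.pruned-⊆ x v p)
  ... | borrowed r x≡j eq pr = borrowedⱼ r x≡j eq pr
  ... | own a eq pa = byVar (x ≟ j)
    where
    byVar : Dec (x ≡ j) → PⱼView x v
    byVar (yes refl) = ⊥-elim (Pⱼ.pruned-drop v (subst (T ∘ isOwn) (sym eq) tt) p)
    byVar (no x≢j) = ownⱼ a x≢j eq (elim-transfer I tij x (T-∧ˡ px) (merged-≢i px) x≢j a pa)

  backⱼ : RawPoint I → RawPoint merged
  backⱼ (k , a) with k ≟ i
  ... | yes refl = j , d I j ↑ʳ a
  ... | no _ = k , a ↑ˡ d I i

  backⱼ-i : ∀ r → backⱼ (i , r) ≡ (j , d I j ↑ʳ r)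
  backⱼ-i r with i ≟ i
  ... | yes refl = refl
  ... | no i≢i = ⊥-elim (i≢i refl)

  backⱼ-other : ∀ k a → k ≢ i → backⱼ (k , a) ≡ (k , a ↑ˡ d I i)
  backⱼ-other k a k≢i with k ≟ i
  ... | yes k≡i = ⊥-elim (k≢i k≡i)
  ... | no _ = refl

  Pⱼ≅elimⱼ : Pⱼ.pruned ≅ elim I j
  Pⱼ≅elimⱼ = PointBijection.≅-pointBijection Pⱼ.pruned (elim I j) toⱼ fromⱼ
    (λ _ → Var-≡ {merged} (transpose-inverse i j)) (λ _ → Var-≡ {elim I j} (transpose-inverse j i))
    e e-var e-active e-injective e-surjective (λ p q → Rˢ-≢ (e p) (e q))
    where
    e : Point Pⱼ.pruned → RawPoint (elim I j)
    e ((x , _) , (v , _)) = source x v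

    view : ∀ p → PⱼView (proj₁ (proj₁ p)) (proj₁ (proj₂ p))
    view ((x , px) , (v , pv)) = Pⱼ-view x v px pv

    e-var : ∀ p → proj₁ (e p) ≡ transpose j i (proj₁ (proj₁ p))
    e-var p@((x , px) , _) with view p
    ... | borrowedⱼ r refl eq _ = trans (cong (proj₁ ∘ sourceᵇ j) eq) (sym (transpose-matchˡ j i))
    ... | ownⱼ a x≢j eq _ = trans (cong (proj₁ ∘ sourceᵇ x) eq) (sym (transpose-other x≢j (merged-≢i px)))

    e-active : ∀ p → Active (elim I j) (e p)
    e-active p@((x , _) , _) with view p
    ... | borrowedⱼ r refl eq pr = subst (Active (elim I j)) (sym (cong (sourceᵇ j) eq)) pr
    ... | ownⱼ a _ eq pa = subst (Active (elim I j)) (sym (cong (sourceᵇ x) eq)) pa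

    raw≡back : ∀ p → raw {Pⱼ.pruned} p ≡ backⱼ (e p)
    raw≡back p@((x , px) , (v , _)) with view p
    ... | borrowedⱼ r refl eq _ =
      trans (cong (j ,_) (sym (splitAt⁻¹-↑ʳ eq))) (sym (trans (cong (backⱼ ∘ sourceᵇ j) eq) (backⱼ-i r)))
    ... | ownⱼ a _ eq _ =
      trans (cong (x ,_) (sym (splitAt⁻¹-↑ˡ eq)))
            (sym (trans (cong (backⱼ ∘ sourceᵇ x) eq) (backⱼ-other x a (merged-≢i px))))

    e-injective : ∀ {p q} → e p ≡ e q → p ≡ q
    e-injective {p} {q} e≡ =
      raw-injective {Pⱼ.pruned} (trans (raw≡back p) (trans (cong backⱼ e≡) (sym (raw≡back q))))

    e-surjective : ∀ q → Σ[ p ∈ Point Pⱼ.pruned ] e p ≡ raw {elim I j} q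
    e-surjective ((y , py) , (a , pa)) = byVar (y ≟ i)
      where
      byVar : Dec (y ≡ i) → Σ[ p ∈ Point Pⱼ.pruned ] e p ≡ (y , a)
      byVar (yes refl) =
        ((j , merged-j) , (d I j ↑ʳ a , Pⱼ.pruned-keep (d I j ↑ʳ a)
           (subst (¬_ ∘ T ∘ isOwn) (sym a-borrowed) (λ ()))
           (subst (T ∘ activeᵇ j) (sym a-borrowed) (T-∧⁺ (fromWitness {a? = j ≟ j} refl) pa)))) ,
        cong (sourceᵇ j) a-borrowed
        where a-borrowed = splitAt-↑ʳ (d I j) (d I i) a
      byVar (no y≢i) = ((y , py′) , (a ↑ˡ d I i , kept)) , cong (sourceᵇ y) a-own
        where
        a-own = splitAt-↑ˡ (d I y) a (d I i)
        y≢j = toWitnessFalse (T-∧ʳ {X I y} py)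
        py′ : T (X merged y)
        py′ = T-∧⁺ {X I y} (T-∧ˡ {X I y} py) (fromWitnessFalse {a? = y ≟ i} y≢i)
        kept : T (D Pⱼ.pruned y (a ↑ˡ d I i))
        kept = Pⱼ.pruned-keep-elsewhere y (a ↑ˡ d I i) y≢j
                 (subst (T ∘ activeᵇ y) (sym a-own) (elim-transfer I tji y (T-∧ˡ py) y≢j y≢i a pa))

lemma2 : (I : Instance) (i j : Fin (n I)) → T (X I i) → T (X I j) → i ≢ j →
         TriangleJustifies I i j → TriangleJustifies I j i →
         (K₁ K₂ : Instance) → IsNS (elim I i) K₁ → IsNS (elim I j) K₂ →
         Isomorphic K₁ K₂
lemma2 I i j pi pj i≢j tij tji K₁ K₂ closure₁ closure₂ =
  ≅⇒Isomorphic (≅-trans K₁≅Kᵢ (≅-trans Kᵢ≅Kⱼ Kⱼ≅K₂))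
  where
  open Merge I i j pi pj i≢j tij tji
  Kᵢ = proj₁ (NS-closure Pᵢ.pruned)
  Kⱼ = proj₁ (NS-closure Pⱼ.pruned)
  closureᵢ : IsNS Pᵢ.pruned Kᵢ
  closureᵢ = proj₂ (NS-closure Pᵢ.pruned)
  closureⱼ : IsNS Pⱼ.pruned Kⱼ
  closureⱼ = proj₂ (NS-closure Pⱼ.pruned)
  K₁≅Kᵢ : K₁ ≅ Kᵢ
  K₁≅Kᵢ = NS-≅ (≅-sym Pᵢ≅elimᵢ) closure₁ closureᵢ
  Kᵢ≅Kⱼ : Kᵢ ≅ Kⱼ
  Kᵢ≅Kⱼ = NS-≅ ≅-refl (IsNS-◅◅ Pᵢ.pruned-path closureᵢ) (IsNS-◅◅ Pⱼ.pruned-path closureⱼ)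
  Kⱼ≅K₂ : Kⱼ ≅ K₂
  Kⱼ≅K₂ = NS-≅ Pⱼ≅elimⱼ closureⱼ closure₂
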